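{- If $\mathcal P$ is a $k$-orbit $n$-polytope and $\mathcal Q$ is an $m$-orbit $n$-polytope, then for any flag $\Phi$ of $\mathcal P$ and any flag $\Psi$ of $\mathcal Q$, the underlying maniplex of $(\mathcal P,\Phi)\diamond(\mathcal Q,\Psi)$ has at most $km$ flag orbits under its automorphism group.
   Context: An $n$-polytope is an abstract polytope of rank $n$; for a flag $\Phi$ and $i\in\{0,\dots,n-1\}$, $\Phi^i$ is the unique flag differing from $\Phi$ only in its $i$-face. A $k$-orbit polytope is one whose automorphism group has exactly $k$ orbits on flags. The flag graph $\mathcal G_{\mathcal P}$ has the flags as vertices and an $i$-edge between $\Phi$ and $\Phi^i$. The mix $(\mathcal P,\Phi)\diamond(\mathcal Q,\Psi)$ is the rooted graph obtained as the connected component containing $(\Phi,\Psi)$ of the graph on $V(\mathcal G_{\mathcal P})\times V(\mathcal G_{\mathcal Q})$ with an $i$-edge between $(\Phi_1,\Psi_1)$ and $(\Phi_2,\Psi_2)$ iff $\Phi_1\Phi_2$ is an $i$-edge of $\mathcal G_{\mathcal P}$ and $\Psi_1\Psi_2$ is an $i$-edge of $\mathcal G_{\mathcal Q}$. It is a maniplex (connected, properly edge-colored with colors $0,\dots,n-1$, each vertex on one edge of each color, $i,j$-alternating 4-cycles for $|i-j|\ge2$); its vertices are its flags and its automorphisms are the color-preserving graph automorphisms. -}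

module Defs where

open import Data.Nat using (ℕ; suc)
open import Data.Fin as Fin using (Fin; toℕ; inject₁; fromℕ)
open import Data.Product using (Σ; ∃; ∃-syntax; _×_; _,_; proj₁; proj₂)
open import Data.Sum using (_⊎_)
open import Relation.Nullary using (¬_)
open import Relation.Binary.PropositionalEquality using (_≡_; _≢_)
open import Relation.Binary.Structures using (IsPartialOrder)
open import Function.Bundles using (_⇔_)

-- Ranked posets.  Ranks -1,0,…,n are encoded as indices 0,1,…,n+1 of
-- Fin (suc (suc n)) (index = rank + 1).

record GradedPoset (n : ℕ) : Set₁ where
  field
    Face           : Set
    _≼_            : Face → Face → Set
    isPartialOrder : IsPartialOrder _≡_ _≼_
    rank           : Face → Fin (suc (suc n))
    least          : Face
    least-min      : ∀ x → least ≼ x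
    greatest       : Face
    greatest-max   : ∀ x → x ≼ greatest
    rank-least     : rank least ≡ Fin.zero
    rank-greatest  : rank greatest ≡ fromℕ (suc n)
    -- rank is strictly monotone and covers raise the rank by exactly one;
    -- together: every maximal chain (flag) has exactly n+2 faces, one per rank
    rank-mono      : ∀ {x y} → x ≼ y → x ≢ y → toℕ (rank x) Data.Nat.< toℕ (rank y)
    cover-rank     : ∀ {x y} → x ≼ y → x ≢ y →
                     (∀ z → x ≼ z → z ≼ y → z ≡ x ⊎ z ≡ y) →
                     toℕ (rank y) ≡ suc (toℕ (rank x))

  _≺_ : Face → Face → Set
  x ≺ y = (x ≼ y) × (x ≢ y)

open import Data.Nat using (_<_)

module _ {n : ℕ} (P : GradedPoset n) where
  open GradedPoset P

  record Flag : Set where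
    field
      face    : Fin (suc (suc n)) → Face
      face-rk : ∀ j → rank (face j) ≡ j
      chain   : ∀ {j l} → j Fin.≤ l → face j ≼ face l

  open Flag public

  -- index of the face of rank i (i ∈ {0,…,n-1})
  pos : Fin n → Fin (suc (suc n))
  pos i = Fin.suc (inject₁ i)

  Adj : Fin n → Flag → Flag → Set
  Adj i Φ Ψ = (∀ j → j ≢ pos i → face Φ j ≡ face Ψ j) × (face Φ (pos i) ≢ face Ψ (pos i))

  _≈F_ : Flag → Flag → Set
  Φ ≈F Ψ = ∀ j → face Φ j ≡ face Ψ j

  data ConnPath (C : Flag → Set) : Flag → Flag → Set where
    done : ∀ {Φ Ψ} → C Φ → Φ ≈F Ψ → ConnPath C Φ Ψ
    step : ∀ {Φ Φ' Ψ} (i : Fin n) → C Φ → Adj i Φ Φ' → ConnPath C Φ' Ψ → ConnPath C Φ Ψ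

record IsPolytope {n : ℕ} (P : GradedPoset n) : Set where
  open GradedPoset P
  field
    diamond : ∀ x y → x ≼ y → toℕ (rank y) ≡ suc (suc (toℕ (rank x))) →
              Σ Face λ z₁ → Σ Face λ z₂ → (z₁ ≢ z₂) ×
                (x ≺ z₁ × z₁ ≺ y) × (x ≺ z₂ × z₂ ≺ y) ×
                (∀ z → x ≺ z → z ≺ y → z ≡ z₁ ⊎ z ≡ z₂)
    -- strong flag-connectivity: any two flags are joined by a sequence of
    -- adjacent flags each containing Φ ∩ Ψ
    strongly-flag-connected : ∀ (Φ Ψ : Flag P) →
      ConnPath P (λ Χ → ∀ j → face Φ j ≡ face Ψ j → face Χ j ≡ face Φ j) Φ Ψ

record Polytope (n : ℕ) : Set₁ where
  field
    poset      : GradedPoset n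
    isPolytope : IsPolytope poset
  open GradedPoset poset public

open Polytope public using (poset)

record Aut {n : ℕ} (P : Polytope n) : Set where
  open Polytope P
  field
    fun     : Face → Face
    inv     : Face → Face
    inv-r   : ∀ x → fun (inv x) ≡ x
    inv-l   : ∀ x → inv (fun x) ≡ x
    mono    : ∀ {x y} → x ≼ y → fun x ≼ fun y
    reflect : ∀ {x y} → fun x ≼ fun y → x ≼ y

SameOrbit : ∀ {n} (P : Polytope n) → Flag (poset P) → Flag (poset P) → Set
SameOrbit P Φ Ψ = Σ (Aut P) λ α → ∀ j → Aut.fun α (face Φ j) ≡ face Ψ j

IsKOrbit : ∀ {n} (P : Polytope n) (k : ℕ) → Set
IsKOrbit P k = Σ (Fin k → Flag (poset P)) λ rep →
  (∀ Φ → ∃[ i ] SameOrbit P (rep i) Φ) ×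
  (∀ i j → SameOrbit P (rep i) (rep j) → i ≡ j)

-- The mix (P,Φ) ◇ (Q,Ψ): connected component of (Φ,Ψ) in the product
-- flag graph (i-edges iff i-edges in both coordinates).

module Mix {n : ℕ} (P Q : Polytope n) (Φ : Flag (poset P)) (Ψ : Flag (poset Q)) where

  Pair : Set
  Pair = Flag (poset P) × Flag (poset Q)

  PairAdj : Fin n → Pair → Pair → Set
  PairAdj i (a , b) (a' , b') = Adj (poset P) i a a' × Adj (poset Q) i b b'

  _≈P_ : Pair → Pair → Set
  (a , b) ≈P (a' , b') = _≈F_ (poset P) a a' × _≈F_ (poset Q) b b'

  data Reach : Pair → Set where
    root : ∀ {u} → (Φ , Ψ) ≈P u → Reach u
    step : ∀ {u v} (i : Fin n) → Reach u → PairAdj i u v → Reach v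

  MixFlag : Set
  MixFlag = Σ Pair Reach

  _≈_ : MixFlag → MixFlag → Set
  u ≈ v = proj₁ u ≈P proj₁ v

  MixAdj : Fin n → MixFlag → MixFlag → Set
  MixAdj i u v = PairAdj i (proj₁ u) (proj₁ v)

  record MixAut : Set where
    field
      fun     : MixFlag → MixFlag
      inv     : MixFlag → MixFlag
      fun-cong : ∀ {u v} → u ≈ v → fun u ≈ fun v
      inv-cong : ∀ {u v} → u ≈ v → inv u ≈ inv v
      inv-r   : ∀ u → fun (inv u) ≈ u
      inv-l   : ∀ u → inv (fun u) ≈ u
      pres    : ∀ i u v → MixAdj i u v ⇔ MixAdj i (fun u) (fun v)

  MixSameOrbit : MixFlag → MixFlag → Set
  MixSameOrbit u v = Σ MixAut λ σ → MixAut.fun σ u ≈ v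

  AtMostOrbits : ℕ → Set
  AtMostOrbits c = ∀ (f : Fin (suc c) → MixFlag) →
    Σ (Fin (suc c)) λ i → Σ (Fin (suc c)) λ j → (i ≢ j) × MixSameOrbit (f i) (f j)

-- An automorphism of P (resp. Q) maps flags to flags and i-adjacent flags to
-- i-adjacent flags, so a pair (α, β) acts on the product flag graph and
-- permutes its connected components.  If (α, β) sends one flag of the mix
-- into the mix, it therefore restricts to an automorphism of the mix.  Two
-- flags (Φ₁, Ψ₁), (Φ₂, Ψ₂) of the mix with Φ₁, Φ₂ in the same Γ(P)-orbit and
-- Ψ₁, Ψ₂ in the same Γ(Q)-orbit are thus in the same orbit of the mix, and
-- the pigeonhole principle on the k·m pairs of orbits bounds the number of
-- orbits of the mix by k·m.
module Submission where

open import Defs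
open import Data.Nat using (ℕ; zero; suc; _+_; _∸_; _*_; _≤_; _<_; z≤n; s≤s)
open import Data.Nat.Properties
  using (≤-refl; ≤-trans; ≤-antisym; ≤-pred; <-trans; n<1+n; <⇒≤; m≤n+m; +-suc;
         +-monoʳ-≤; +-cancelˡ-≤; m∸n+n≡m; module ≤-Reasoning)
open import Data.Fin as Fin using (Fin; toℕ; fromℕ<)
open import Data.Fin.Properties using (toℕ-injective; toℕ<n; toℕ-fromℕ<; fromℕ<-toℕ; combine-injective; pigeonhole; <⇒≢)
open import Data.Product using (Σ; _,_; proj₁; proj₂)
open import Relation.Binary.PropositionalEquality using (_≡_; refl; sym; trans; cong; subst; subst₂)
open import Function.Bundles using (mk⇔)

module _ {N : ℕ} (g : Fin (suc N) → Fin (suc N))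
         (g-strict : ∀ {j l} → j Fin.< l → g j Fin.< g l) where

  private
    lower-bound : ∀ i (i<1+N : i < suc N) → i ≤ toℕ (g (fromℕ< i<1+N))
    lower-bound zero    _       = z≤n
    lower-bound (suc i) i+1<1+N = ≤-trans (s≤s (lower-bound i i<1+N)) (g-strict i<i+1)
      where
      i<1+N : i < suc N
      i<1+N = <-trans (n<1+n i) i+1<1+N
      i<i+1 : fromℕ< i<1+N Fin.< fromℕ< i+1<1+N
      i<i+1 = subst₂ _<_ (sym (toℕ-fromℕ< i<1+N)) (sym (toℕ-fromℕ< i+1<1+N)) (n<1+n i)

    -- The d indices above j are mapped strictly above g j.
    upper-bound : ∀ d j → d + toℕ j ≤ N → d + toℕ (g j) ≤ N
    upper-bound zero    j _  = ≤-pred (toℕ<n (g j))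
    upper-bound (suc d) j le = begin
      suc d + toℕ (g j)   ≡⟨ sym (+-suc d (toℕ (g j))) ⟩
      d + suc (toℕ (g j)) ≤⟨ +-monoʳ-≤ d (g-strict j<j′) ⟩
      d + toℕ (g j′)      ≤⟨ upper-bound d j′ (subst (_≤ N) (sym d+j′≡) le) ⟩
      N                   ∎
      where
      open ≤-Reasoning
      j+1<1+N : suc (toℕ j) < suc N
      j+1<1+N = s≤s (≤-trans (m≤n+m (suc (toℕ j)) d) (subst (_≤ N) (sym (+-suc d (toℕ j))) le))
      j′ : Fin (suc N)
      j′ = fromℕ< j+1<1+N
      j<j′ : j Fin.< j′
      j<j′ = subst (toℕ j <_) (sym (toℕ-fromℕ< j+1<1+N)) ≤-refl
      d+j′≡ : d + toℕ j′ ≡ suc d + toℕ j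
      d+j′≡ = trans (cong (d +_) (toℕ-fromℕ< j+1<1+N)) (+-suc d (toℕ j))

  strictlyIncreasing⇒id : ∀ j → g j ≡ j
  strictlyIncreasing⇒id j = toℕ-injective (≤-antisym g≤ ≤g)
    where
    j≤N : toℕ j ≤ N
    j≤N = ≤-pred (toℕ<n j)
    ≤g : toℕ j ≤ toℕ (g j)
    ≤g = subst (λ x → toℕ j ≤ toℕ (g x)) (fromℕ<-toℕ j (toℕ<n j)) (lower-bound (toℕ j) (toℕ<n j))
    g≤ : toℕ (g j) ≤ toℕ j
    g≤ = +-cancelˡ-≤ (N ∸ toℕ j) (toℕ (g j)) (toℕ j)
           (subst (N ∸ toℕ j + toℕ (g j) ≤_) (sym (m∸n+n≡m j≤N))
             (upper-bound (N ∸ toℕ j) j (subst (_≤ N) (sym (m∸n+n≡m j≤N)) ≤-refl)))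

module Automorphisms {n : ℕ} (P : Polytope n) where
  open Polytope P hiding (poset)

  private
    Flagᴾ : Set
    Flagᴾ = Flag (poset P)

  Aut-injective : (α : Aut P) → ∀ {x y} → Aut.fun α x ≡ Aut.fun α y → x ≡ y
  Aut-injective α {x} {y} eq = trans (sym (Aut.inv-l α x)) (trans (cong (Aut.inv α) eq) (Aut.inv-l α y))

  infix  10 _⁻¹ᴬ
  infixr 9 _∘ᴬ_
  infixr 5 _·_

  _⁻¹ᴬ : Aut P → Aut P
  α ⁻¹ᴬ = record
    { fun     = Aut.inv α
    ; inv     = Aut.fun α
    ; inv-r   = Aut.inv-l α
    ; inv-l   = Aut.inv-r α
    ; mono    = λ {x} {y} x≼y → Aut.reflect α (subst₂ _≼_ (sym (Aut.inv-r α x)) (sym (Aut.inv-r α y)) x≼y)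
    ; reflect = λ {x} {y} αx≼αy → subst₂ _≼_ (Aut.inv-r α x) (Aut.inv-r α y) (Aut.mono α αx≼αy)
    }

  _∘ᴬ_ : Aut P → Aut P → Aut P
  β ∘ᴬ α = record
    { fun     = λ x → Aut.fun β (Aut.fun α x)
    ; inv     = λ x → Aut.inv α (Aut.inv β x)
    ; inv-r   = λ x → trans (cong (Aut.fun β) (Aut.inv-r α _)) (Aut.inv-r β x)
    ; inv-l   = λ x → trans (cong (Aut.inv α) (Aut.inv-l β _)) (Aut.inv-l α x)
    ; mono    = λ x≼y → Aut.mono β (Aut.mono α x≼y)
    ; reflect = λ x≼y → Aut.reflect α (Aut.reflect β x≼y)
    }

  -- The image faces of a flag have the right ranks because j ↦ rank (α (Φ j))
  -- is a strictly increasing self-map of the ranks.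
  _·_ : Aut P → Flagᴾ → Flagᴾ
  α · Φ = record
    { face    = λ j → Aut.fun α (face Φ j)
    ; face-rk = strictlyIncreasing⇒id (λ j → rank (Aut.fun α (face Φ j))) rank-strict
    ; chain   = λ j≤l → Aut.mono α (chain Φ j≤l)
    }
    where
    rank-strict : ∀ {j l} → j Fin.< l → toℕ (rank (Aut.fun α (face Φ j))) < toℕ (rank (Aut.fun α (face Φ l)))
    rank-strict {j} {l} j<l = rank-mono (Aut.mono α (chain Φ (<⇒≤ j<l))) λ eq →
      <⇒≢ j<l (trans (sym (face-rk Φ j)) (trans (cong rank (Aut-injective α eq)) (face-rk Φ l)))

  ·-Adj : (α : Aut P) → ∀ i Φ Φ′ → Adj (poset P) i Φ Φ′ → Adj (poset P) i (α · Φ) (α · Φ′)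
  ·-Adj α i _ _ (same , differ) = (λ j j≢i → cong (Aut.fun α) (same j j≢i)) , λ eq → differ (Aut-injective α eq)

  ·-Adj⁻ : (α : Aut P) → ∀ i Φ Φ′ → Adj (poset P) i (α · Φ) (α · Φ′) → Adj (poset P) i Φ Φ′
  ·-Adj⁻ α i _ _ (same , differ) = (λ j j≢i → Aut-injective α (same j j≢i)) , λ eq → differ (cong (Aut.fun α) eq)

  Adj-sym : ∀ i Φ Φ′ → Adj (poset P) i Φ Φ′ → Adj (poset P) i Φ′ Φ
  Adj-sym i _ _ (same , differ) = (λ j j≢i → sym (same j j≢i)) , λ eq → differ (sym eq)

  Adj-respʳ : ∀ i Φ Φ′ Φ″ → Adj (poset P) i Φ Φ′ → _≈F_ (poset P) Φ′ Φ″ → Adj (poset P) i Φ Φ″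
  Adj-respʳ i _ _ _ (same , differ) Φ′≈Φ″ =
    (λ j j≢i → trans (same j j≢i) (Φ′≈Φ″ j)) , λ eq → differ (trans eq (sym (Φ′≈Φ″ _)))

  module Orbits {k : ℕ} (K : IsKOrbit P k) where

    orbitIndex : Flagᴾ → Fin k
    orbitIndex Φ = proj₁ (proj₁ (proj₂ K) Φ)

    sameIndex⇒sameOrbit : ∀ Φ Φ′ → orbitIndex Φ ≡ orbitIndex Φ′ → Σ (Aut P) λ α → _≈F_ (poset P) (α · Φ) Φ′
    sameIndex⇒sameOrbit Φ Φ′ eq with proj₁ (proj₂ K) Φ | proj₁ (proj₂ K) Φ′
    ... | _ , α , αρ≈Φ | _ , β , βρ≈Φ′ with refl ← eq = β ∘ᴬ α ⁻¹ᴬ , βα⁻¹Φ≈Φ′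
      where
      βα⁻¹Φ≈Φ′ : _≈F_ (poset P) ((β ∘ᴬ α ⁻¹ᴬ) · Φ) Φ′
      βα⁻¹Φ≈Φ′ j = trans (cong (Aut.fun β) (trans (cong (Aut.inv α) (sym (αρ≈Φ j))) (Aut.inv-l α _))) (βρ≈Φ′ j)

module ProductAction {n : ℕ} (P Q : Polytope n) (Φ : Flag (poset P)) (Ψ : Flag (poset Q)) where
  open Mix P Q Φ Ψ
  private
    module AP = Automorphisms P
    module AQ = Automorphisms Q

  ≈P-sym : ∀ u v → u ≈P v → v ≈P u
  ≈P-sym _ _ (a≈a′ , b≈b′) = (λ j → sym (a≈a′ j)) , (λ j → sym (b≈b′ j))

  ≈P-trans : ∀ u v w → u ≈P v → v ≈P w → u ≈P w
  ≈P-trans _ _ _ (a≈a′ , b≈b′) (a′≈a″ , b′≈b″) = (λ j → trans (a≈a′ j) (a′≈a″ j)) , (λ j → trans (b≈b′ j) (b′≈b″ j))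

  PairAdj-sym : ∀ i u v → PairAdj i u v → PairAdj i v u
  PairAdj-sym i (a , b) (a′ , b′) (adjP , adjQ) = AP.Adj-sym i a a′ adjP , AQ.Adj-sym i b b′ adjQ

  Reach-resp : ∀ {u} v → Reach u → u ≈P v → Reach v
  Reach-resp {u} v (root root≈u) u≈v = root (≈P-trans (Φ , Ψ) u v root≈u u≈v)
  Reach-resp (a″ , b″) (step {a , b} {a′ , b′} i r (adjP , adjQ)) (a′≈a″ , b′≈b″) =
    step i r (AP.Adj-respʳ i a a′ a″ adjP a′≈a″ , AQ.Adj-respʳ i b b′ b″ adjQ b′≈b″)

  infixr 5 _⊗_·_

  _⊗_·_ : Aut P → Aut Q → Pair → Pair
  (α ⊗ β · u) = α AP.· proj₁ u , β AQ.· proj₂ u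

  ⊗-cong : ∀ α β u v → u ≈P v → (α ⊗ β · u) ≈P (α ⊗ β · v)
  ⊗-cong α β _ _ (a≈a′ , b≈b′) = (λ j → cong (Aut.fun α) (a≈a′ j)) , (λ j → cong (Aut.fun β) (b≈b′ j))

  ⊗-inverseˡ : ∀ α β u → (α AP.⁻¹ᴬ ⊗ β AQ.⁻¹ᴬ · α ⊗ β · u) ≈P u
  ⊗-inverseˡ α β u = (λ j → Aut.inv-l α _) , (λ j → Aut.inv-l β _)

  ⊗-PairAdj : ∀ α β i u v → PairAdj i u v → PairAdj i (α ⊗ β · u) (α ⊗ β · v)
  ⊗-PairAdj α β i (a , b) (a′ , b′) (adjP , adjQ) = AP.·-Adj α i a a′ adjP , AQ.·-Adj β i b b′ adjQ

  ⊗-PairAdj⁻ : ∀ α β i u v → PairAdj i (α ⊗ β · u) (α ⊗ β · v) → PairAdj i u v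
  ⊗-PairAdj⁻ α β i (a , b) (a′ , b′) (adjP , adjQ) = AP.·-Adj⁻ α i a a′ adjP , AQ.·-Adj⁻ β i b b′ adjQ

  -- Walk the path from the root to w backwards, inside the image.
  Reach-⊗-root : ∀ α β {w} → Reach w → Reach (α ⊗ β · w) → Reach (α ⊗ β · (Φ , Ψ))
  Reach-⊗-root α β {w} (root root≈w) r =
    Reach-resp (α ⊗ β · (Φ , Ψ)) r (⊗-cong α β w (Φ , Ψ) (≈P-sym (Φ , Ψ) w root≈w))
  Reach-⊗-root α β (step {u} {v} i r adj) r′ =
    Reach-⊗-root α β r (step i r′ (PairAdj-sym i (α ⊗ β · u) (α ⊗ β · v) (⊗-PairAdj α β i u v adj)))

  Reach-⊗ : ∀ α β → Reach (α ⊗ β · (Φ , Ψ)) → ∀ {u} → Reach u → Reach (α ⊗ β · u)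
  Reach-⊗ α β r₀ {u} (root root≈u)    = Reach-resp (α ⊗ β · u) r₀ (⊗-cong α β (Φ , Ψ) u root≈u)
  Reach-⊗ α β r₀ (step {u} {v} i r adj) = step i (Reach-⊗ α β r₀ r) (⊗-PairAdj α β i u v adj)

  ⊗-MixAut : ∀ α β → Reach (α ⊗ β · (Φ , Ψ)) → Reach (α AP.⁻¹ᴬ ⊗ β AQ.⁻¹ᴬ · (Φ , Ψ)) → MixAut
  ⊗-MixAut α β r₀ r₀⁻ = record
    { fun      = λ u → (α ⊗ β · proj₁ u) , Reach-⊗ α β r₀ (proj₂ u)
    ; inv      = λ u → (α⁻ ⊗ β⁻ · proj₁ u) , Reach-⊗ α⁻ β⁻ r₀⁻ (proj₂ u)
    ; fun-cong = λ {u} {v} → ⊗-cong α β (proj₁ u) (proj₁ v)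
    ; inv-cong = λ {u} {v} → ⊗-cong α⁻ β⁻ (proj₁ u) (proj₁ v)
    ; inv-r    = λ u → ⊗-inverseˡ α⁻ β⁻ (proj₁ u)
    ; inv-l    = λ u → ⊗-inverseˡ α β (proj₁ u)
    ; pres     = λ i u v → mk⇔ (⊗-PairAdj α β i (proj₁ u) (proj₁ v)) (⊗-PairAdj⁻ α β i (proj₁ u) (proj₁ v))
    }
    where
    α⁻ = α AP.⁻¹ᴬ
    β⁻ = β AQ.⁻¹ᴬ

  ⊗-MixSameOrbit : ∀ α β (w w′ : MixFlag) → (α ⊗ β · proj₁ w) ≈P proj₁ w′ → MixSameOrbit w w′
  ⊗-MixSameOrbit α β (w , rw) (w′ , rw′) αβw≈w′ = ⊗-MixAut α β r₀ r₀⁻ , αβw≈w′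
    where
    α⁻ = α AP.⁻¹ᴬ
    β⁻ = β AQ.⁻¹ᴬ
    w≈α⁻β⁻w′ : w ≈P (α⁻ ⊗ β⁻ · w′)
    w≈α⁻β⁻w′ = ≈P-trans w (α⁻ ⊗ β⁻ · α ⊗ β · w) (α⁻ ⊗ β⁻ · w′)
                 (≈P-sym (α⁻ ⊗ β⁻ · α ⊗ β · w) w (⊗-inverseˡ α β w))
                 (⊗-cong α⁻ β⁻ (α ⊗ β · w) w′ αβw≈w′)
    r₀ = Reach-⊗-root α β rw (Reach-resp (α ⊗ β · w) rw′ (≈P-sym (α ⊗ β · w) w′ αβw≈w′))
    r₀⁻ = Reach-⊗-root α⁻ β⁻ rw′ (Reach-resp (α⁻ ⊗ β⁻ · w′) rw w≈α⁻β⁻w′)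

mainTheorem3 : ∀ {n : ℕ} (P Q : Polytope n) (k m : ℕ) →
    IsKOrbit P k → IsKOrbit Q m →
    (Φ : Flag (poset P)) (Ψ : Flag (poset Q)) →
    Mix.AtMostOrbits P Q Φ Ψ (k * m)
mainTheorem3 P Q k m KP KQ Φ Ψ f =
  let i , j , i<j , sameIndices = pigeonhole (n<1+n (k * m)) orbitIndices
      sameIndexᴾ , sameIndexᴽ   = combine-injective _ _ _ _ sameIndices
      α , αΦᵢ≈Φⱼ = OrbitsP.sameIndex⇒sameOrbit _ _ sameIndexᴾ
      β , βΨᵢ≈Ψⱼ = OrbitsQ.sameIndex⇒sameOrbit _ _ sameIndexᴽ
  in i , j , <⇒≢ i<j , ⊗-MixSameOrbit α β (f i) (f j) (αΦᵢ≈Φⱼ , βΨᵢ≈Ψⱼ)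
  where
  open ProductAction P Q Φ Ψ using (⊗-MixSameOrbit)
  module OrbitsP = Automorphisms.Orbits P KP
  module OrbitsQ = Automorphisms.Orbits Q KQ
  orbitIndices : Fin (suc (k * m)) → Fin (k * m)
  orbitIndices i = Fin.combine (OrbitsP.orbitIndex (proj₁ (proj₁ (f i)))) (OrbitsQ.orbitIndex (proj₂ (proj₁ (f i))))
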